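{- Let $G$ be a connected $Z_1$-free graph. If there exists a vertex $v\in V(G)$ with $d(v)\ge 3$ such that $v$ is contained in a triangle, then $G$ is isomorphic to a complete multipartite graph $K_{t_1,t_2,\dots,t_k}$.
   Context: All graphs are finite and simple. $Z_1$ is the graph obtained from $K_{1,3}$ by adding one edge between two of its leaves. A graph is $Z_1$-free if it has no induced subgraph isomorphic to $Z_1$. $d(v)$ denotes the degree of $v$. -}

module Defs where

open import Data.Nat using (ℕ; _≥_)
open import Data.Fin using (Fin)
open import Data.Bool using (Bool; true; false)
open import Data.List using (length; filterᵇ; allFin)
open import Data.Product using (Σ; ∃; ∃-syntax; _×_; _,_)
open import Relation.Nullary using (¬_)
open import Relation.Binary.PropositionalEquality using (_≡_; _≢_)
open import Relation.Binary.Construct.Closure.ReflexiveTransitive using (Star)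
open import Function.Definitions using (Surjective)

record Graph (n : ℕ) : Set where
  field
    adj    : Fin n → Fin n → Bool
    sym    : ∀ u v → adj u v ≡ adj v u
    irrefl : ∀ v → adj v v ≡ false

open Graph public

Adj : ∀ {n} → Graph n → Fin n → Fin n → Set
Adj G u v = adj G u v ≡ true

degree : ∀ {n} → Graph n → Fin n → ℕ
degree {n} G v = length (filterᵇ (adj G v) (allFin n))

Connected : ∀ {n} → Graph n → Set
Connected G = ∀ u v → Star (Adj G) u v

-- an induced Z1 (paw): centre a adjacent to b, c, d; b adjacent to c;
-- d adjacent to neither b nor c; the four vertices distinct
-- (a ≠ b, c, d and b ≠ c follow from looplessness).
InducedZ1 : ∀ {n} → Graph n → Fin n → Fin n → Fin n → Fin n → Set
InducedZ1 G a b c d =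
  Adj G a b × Adj G a c × Adj G a d × Adj G b c ×
  ¬ Adj G b d × ¬ Adj G c d × b ≢ d × c ≢ d

Z1Free : ∀ {n} → Graph n → Set
Z1Free G = ∀ a b c d → ¬ InducedZ1 G a b c d

InTriangle : ∀ {n} → Graph n → Fin n → Set
InTriangle G v = ∃[ u ] ∃[ w ] (Adj G v u × Adj G v w × Adj G u w)

-- G is isomorphic to a complete multipartite graph K_{t_1,...,t_k}
-- (all t_i ≥ 1): the vertex set is partitioned into k nonempty classes
-- (fibres of a surjection onto Fin k) such that two vertices are
-- adjacent exactly when they lie in different classes.
CompleteMultipartite : ∀ {n} → Graph n → Set
CompleteMultipartite {n} G =
  ∃[ k ] Σ (Fin n → Fin k) λ part →
    Surjective _≡_ _≡_ part ×
    (∀ u v → (Adj G u v → part u ≢ part v) × (part u ≢ part v → Adj G u v))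

module Submission where

-- We show that
-- non-adjacency is an equivalence relation on V(G); its classes are then the
-- parts of a complete multipartite structure.
--
--  * Quotients: a decidable equivalence relation on Fin n is the kernel of a
--    surjection onto some Fin k (proved by induction on n).
--  * In a paw-free graph a triangle at x yields a triangle at every neighbour
--    of x, so by connectedness every vertex lies in a triangle.
--  * A path y–z–u–w inducing P₄ cannot have z in a triangle; hence, for every
--    edge uw, a vertex non-adjacent to both u and w has all its neighbours
--    non-adjacent to both as well.  Walking to u, connectedness shows that
--    every vertex is adjacent to u or to w.
--  * Consequently u ≁ v and v ≁ w force u ≁ w: non-adjacency is transitive,
--    and lemma3 follows by taking the quotient by non-adjacency.

open import Defs
open import Data.Nat using (zero; suc; _≥_)
open import Data.Fin using (Fin; zero; suc)
open import Data.Fin.Properties using (any?; suc-injective; 0≢1+n)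
open import Data.Bool using (true; _≟_)
open import Data.Product using (∃-syntax; _×_; _,_; Σ)
open import Data.Empty using (⊥; ⊥-elim)
open import Relation.Nullary using (¬_; Dec; yes; no)
open import Relation.Nullary.Decidable using (¬?; decidable-stable)
open import Relation.Binary using (Rel; Decidable; IsDecEquivalence)
open import Relation.Binary.PropositionalEquality using (_≡_; refl; cong)
import Relation.Binary.PropositionalEquality as ≡
open import Relation.Binary.Construct.Closure.ReflexiveTransitive using (Star; ε; _◅_)
open import Function.Bundles using (_⇔_; mk⇔; Equivalence)
open import Function.Definitions using (StrictlySurjective)
open import Function.Consequences.Propositional using (strictlySurjective⇒surjective)

Classifier : ∀ {ℓ n} → Rel (Fin n) ℓ → Set ℓ
Classifier {n = n} R =
  ∃[ k ] Σ (Fin n → Fin k) λ part →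
    StrictlySurjective _≡_ part × (∀ u v → part u ≡ part v ⇔ R u v)

-- Extending a classifier from the vertices 1..n to 0..n, for a decidable
-- equivalence relation R on Fin (suc n).
module Extend {ℓ n} {R : Rel (Fin (suc n)) ℓ} (isDecEq : IsDecEquivalence R) where
  open IsDecEquivalence isDecEq
    renaming (refl to R-refl; sym to R-sym; trans to R-trans; _≟_ to R?)
  open Equivalence

  Tail : Rel (Fin n) ℓ
  Tail i j = R (suc i) (suc j)

  tail-isDecEquivalence : IsDecEquivalence Tail
  tail-isDecEquivalence = record
    { isEquivalence = record { refl = R-refl ; sym = R-sym ; trans = R-trans }
    ; _≟_ = λ i j → R? (suc i) (suc j)
    }

  join-class : ∀ j → R zero (suc j) → Classifier Tail → Classifier R
  join-class j R0j (k , part , onto , kernel) = k , part₀ , onto₀ , kernel₀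
    where
    part₀ : Fin (suc n) → Fin k
    part₀ zero    = part j
    part₀ (suc i) = part i
    onto₀ : StrictlySurjective _≡_ part₀
    onto₀ y with onto y
    ... | i , eq = suc i , eq
    via-j : ∀ i → part j ≡ part i ⇔ R zero (suc i)
    via-j i = mk⇔ (λ e → R-trans R0j (to (kernel j i) e))
                  (λ r → from (kernel j i) (R-trans (R-sym R0j) r))
    kernel₀ : ∀ u v → part₀ u ≡ part₀ v ⇔ R u v
    kernel₀ zero    zero     = mk⇔ (λ _ → R-refl) (λ _ → refl)
    kernel₀ zero    (suc i)  = via-j i
    kernel₀ (suc i) zero     = mk⇔ (λ e → R-sym (to (via-j i) (≡.sym e)))
                                   (λ r → ≡.sym (from (via-j i) (R-sym r)))
    kernel₀ (suc i) (suc i′) = kernel i i′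

  new-class : (∀ j → ¬ R zero (suc j)) → Classifier Tail → Classifier R
  new-class isolated (k , part , onto , kernel) = suc k , part₀ , onto₀ , kernel₀
    where
    part₀ : Fin (suc n) → Fin (suc k)
    part₀ zero    = zero
    part₀ (suc i) = suc (part i)
    onto₀ : StrictlySurjective _≡_ part₀
    onto₀ zero = zero , refl
    onto₀ (suc y) with onto y
    ... | i , eq = suc i , cong suc eq
    kernel₀ : ∀ u v → part₀ u ≡ part₀ v ⇔ R u v
    kernel₀ zero    zero     = mk⇔ (λ _ → R-refl) (λ _ → refl)
    kernel₀ zero    (suc i)  = mk⇔ (λ e → ⊥-elim (0≢1+n e)) (λ r → ⊥-elim (isolated i r))
    kernel₀ (suc i) zero     = mk⇔ (λ e → ⊥-elim (0≢1+n (≡.sym e)))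
                                   (λ r → ⊥-elim (isolated i (R-sym r)))
    kernel₀ (suc i) (suc i′) =
      mk⇔ (λ e → to (kernel i i′) (suc-injective e)) (λ r → cong suc (from (kernel i i′) r))

  extend : Classifier Tail → Classifier R
  extend c with any? (λ j → R? zero (suc j))
  ... | yes (j , R0j) = join-class j R0j c
  ... | no  isolated  = new-class (λ j r → isolated (j , r)) c

classify : ∀ {ℓ n} {R : Rel (Fin n) ℓ} → IsDecEquivalence R → Classifier R
classify {n = zero}  _       = zero , (λ ()) , (λ ()) , λ ()
classify {n = suc n} isDecEq = extend (classify tail-isDecEquivalence)
  where open Extend isDecEq

module Basics {n} (G : Graph n) where

  infix 4 _~_ _≁_
  _~_ _≁_ : Fin n → Fin n → Set
  u ~ v = Adj G u v
  u ≁ v = ¬ u ~ v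

  adjacent? : Decidable _~_
  adjacent? u v = adj G u v ≟ true

  ~-sym : ∀ {u v} → u ~ v → v ~ u
  ~-sym {u} {v} uv = ≡.trans (sym G v u) uv

  ≁-sym : ∀ {u v} → u ≁ v → v ≁ u
  ≁-sym u≁v vu = u≁v (~-sym vu)

  ≁-refl : ∀ {v} → v ≁ v
  ≁-refl {v} vv with ≡.trans (≡.sym (irrefl G v)) vv
  ... | ()

module PawFree {n} (G : Graph n) (Z : Z1Free G) where
  open Basics G

  -- A triangle abc with a pendant neighbour d of a is never induced;
  -- distinctness of b, c from d is automatic since b ~ c.
  no-paw : ∀ {a b c d} → a ~ b → a ~ c → a ~ d → b ~ c → b ≁ d → c ≁ d → ⊥
  no-paw ab ac ad bc b≁d c≁d =
    Z _ _ _ _ (ab , ac , ad , bc , b≁d , c≁d ,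
               (λ { refl → c≁d (~-sym bc) }) , (λ { refl → b≁d bc }))

  ≁-trans-in-N : ∀ {z p q r} → z ~ p → z ~ q → z ~ r → p ≁ q → q ≁ r → p ≁ r
  ≁-trans-in-N zp zq zr p≁q q≁r pr = no-paw zp zr zq pr p≁q (≁-sym q≁r)

  -- A triangle at x gives a triangle at every neighbour y of x: otherwise
  -- the triangle xab plus the pendant edge xy is an induced paw.
  triangle-step : ∀ {x y} → InTriangle G x → x ~ y → InTriangle G y
  triangle-step {x} {y} (a , b , xa , xb , ab) xy with adjacent? y a | adjacent? y b
  ... | yes ya | _      = x , a , ~-sym xy , ya , xa
  ... | no _   | yes yb = x , b , ~-sym xy , yb , xb
  ... | no y≁a | no y≁b = ⊥-elim (no-paw xa xb xy ab (≁-sym y≁a) (≁-sym y≁b))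

  triangle-along : ∀ {x y} → InTriangle G x → Star _~_ x y → InTriangle G y
  triangle-along t ε        = t
  triangle-along t (e ◅ xy) = triangle-along (triangle-step t e) xy

  -- Non-adjacency classes inside N(z) contain y and u together, and the
  -- triangle at z yields c ∈ N(z) outside that class, so c ~ y and c ~ u;
  -- then either u (if c ≁ w) or c (if c ~ w) is the centre of a paw.
  no-P₄-at-triangle : ∀ {y z u w} → y ~ z → z ~ u → u ~ w →
    y ≁ u → y ≁ w → z ≁ w → InTriangle G z → ⊥
  no-P₄-at-triangle {y} {z} {u} {w} yz zu uw y≁u y≁w z≁w (a , b , za , zb , ab) =
    paw-at (common-neighbour (adjacent? a y) (adjacent? b y))
    where
    zy = ~-sym yz

    outside-class : ∀ {c} → z ~ c → c ~ y → c ~ u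
    outside-class {c} zc cy with adjacent? c u
    ... | yes cu  = cu
    ... | no c≁u  = ⊥-elim (≁-trans-in-N zc zu zy c≁u (≁-sym y≁u) cy)

    common-neighbour : Dec (a ~ y) → Dec (b ~ y) →
      ∃[ c ] (z ~ c × c ~ y × c ~ u)
    common-neighbour (yes ay) _        = a , za , ay , outside-class za ay
    common-neighbour (no _)   (yes by) = b , zb , by , outside-class zb by
    common-neighbour (no a≁y) (no b≁y) =
      ⊥-elim (≁-trans-in-N za zy zb a≁y (≁-sym b≁y) ab)

    paw-at : ∃[ c ] (z ~ c × c ~ y × c ~ u) → ⊥
    paw-at (c , zc , cy , cu) with adjacent? c w
    ... | no c≁w = no-paw (~-sym zu) (~-sym cu) uw zc z≁w c≁w
    ... | yes cw = no-paw cu cw cy uw (≁-sym y≁u) (≁-sym y≁w)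

module ConnectedPawFree {n} (G : Graph n) (Z : Z1Free G) (C : Connected G)
                        (v₀ : Fin n) (t₀ : InTriangle G v₀) where
  open Basics G
  open PawFree G Z

  every-vertex-in-triangle : ∀ x → InTriangle G x
  every-vertex-in-triangle x = triangle-along t₀ (C v₀ x)

  -- Being non-adjacent to both ends of an edge uw spreads along walks:
  -- a neighbour s′ of s adjacent to exactly one end gives an induced P₄
  -- through s′, and one adjacent to both ends gives a paw centred at s′.
  avoids-edge-along : ∀ {u w s t} → u ~ w → s ≁ u → s ≁ w → Star _~_ s t →
    t ≁ u × t ≁ w
  avoids-edge-along uw s≁u s≁w ε = s≁u , s≁w
  avoids-edge-along {u} {w} uw s≁u s≁w (_◅_ {j = s′} ss′ s′t)
    with adjacent? s′ u | adjacent? s′ w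
  ... | no s′≁u | no s′≁w = avoids-edge-along uw s′≁u s′≁w s′t
  ... | yes s′u | yes s′w =
    ⊥-elim (no-paw s′u s′w (~-sym ss′) uw (≁-sym s≁u) (≁-sym s≁w))
  ... | yes s′u | no s′≁w =
    ⊥-elim (no-P₄-at-triangle ss′ s′u uw s≁u s≁w s′≁w (every-vertex-in-triangle s′))
  ... | no s′≁u | yes s′w =
    ⊥-elim (no-P₄-at-triangle ss′ s′w (~-sym uw) s≁w s≁u s′≁u (every-vertex-in-triangle s′))

  edge-dominating : ∀ {u w s} → u ~ w → s ≁ u → s ≁ w → ⊥
  edge-dominating {u} uw s≁u s≁w with avoids-edge-along uw s≁u s≁w (C _ u)
  ... | _ , u≁w = u≁w uw

  ≁-trans : ∀ {u v w} → u ≁ v → v ≁ w → u ≁ w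
  ≁-trans u≁v v≁w uw = edge-dominating uw (≁-sym u≁v) v≁w

  ≁-isDecEquivalence : IsDecEquivalence _≁_
  ≁-isDecEquivalence = record
    { isEquivalence = record { refl = ≁-refl ; sym = ≁-sym ; trans = ≁-trans }
    ; _≟_ = λ u v → ¬? (adjacent? u v)
    }

-- The classes of non-adjacency are the parts of G.
lemma3 : ∀ {n} (G : Graph n) → Connected G → Z1Free G →
    (∃[ v ] (degree G v ≥ 3 × InTriangle G v)) →
    CompleteMultipartite G
lemma3 G C Z (v₀ , _ , t₀) with classify ≁-isDecEquivalence
  where open ConnectedPawFree G Z C v₀ t₀
... | k , part , onto , kernel =
  k , part , strictlySurjective⇒surjective onto , λ u v →
    (λ uv same → to (kernel u v) same uv) ,
    (λ different → decidable-stable (adjacent? u v) (λ u≁v → different (from (kernel u v) u≁v)))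
  where
  open Basics G
  open Equivalence
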